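{- Let $V$ be a 2-dimensional vector space over a field $k$. Define trilinear forms on $\mathrm{L}(V)$ by $g(a_1,a_2,a_3)=\mathrm{tr}(a_1a_2a_3)-\mathrm{tr}(a_3a_2a_1)$ and $h(a_1,a_2,a_3)=\mathrm{tr}(a_1)\mathrm{tr}(a_2)\mathrm{tr}(a_3)-\mathrm{tr}(a_1a_2a_3)$. Then, as elements of $\mathrm{L}(V^{\otimes3})^*$, $$h=g\circ L_{t_{(321)}}.$$
   Context: $\mathrm{L}(W)$ is the space of linear maps $W\to W$. We identify $\mathrm{L}(V)^{\otimes3}\simeq\mathrm{L}(V^{\otimes3})$ (acting factorwise on $V^{\otimes3}$), so trilinear forms on $\mathrm{L}(V)$ are identified with elements of $\mathrm{L}(V^{\otimes3})^*$ via $\phi(a_1,a_2,a_3)=\phi(a_1\otimes a_2\otimes a_3)$. For $\sigma\in S_3$, $t_\sigma\in\mathrm{L}(V^{\otimes3})$ is $t_\sigma(u_1\otimes u_2\otimes u_3)=u_{\sigma(1)}\otimes u_{\sigma(2)}\otimes u_{\sigma(3)}$; $(321)$ is the cycle $3\mapsto2\mapsto1\mapsto3$. $L_t$ denotes left multiplication by $t$ in $\mathrm{L}(V^{\otimes3})$: $L_t(b)=t\circ b$. -}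

module Defs where

open import Level using (Level; _⊔_)
open import Algebra.Bundles using (CommutativeRing)
open import Data.Fin using (Fin; zero; suc)
open import Data.Fin.Properties using (_≟_)
open import Data.Product using (_×_; _,_; Σ)
open import Relation.Nullary using (¬_; Dec; yes; no)
open import Relation.Nullary.Decidable using (_×-dec_)
open import Relation.Binary.PropositionalEquality using (_≡_)

record Field (c ℓ : Level) : Set (Level.suc (c ⊔ ℓ)) where
  field
    ring : CommutativeRing c ℓ
  open CommutativeRing ring
  field
    1≉0     : ¬ (1# ≈ 0#)
    inverse : ∀ x → ¬ (x ≈ 0#) → Σ Carrier (λ y → x * y ≈ 1#)

-- Coordinates: V = k², a basis e₀ , e₁ of V is fixed.
-- V^{⊗3} has basis e_{i₁} ⊗ e_{i₂} ⊗ e_{i₃}, indexed by I3.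
I3 : Set
I3 = Fin 2 × Fin 2 × Fin 2

-- component m (m ∈ {0,1,2}, i.e. tensor factors 1,2,3) of a multi-index
comp : I3 → Fin 3 → Fin 2
comp (i , j , k) zero = i
comp (i , j , k) (suc zero) = j
comp (i , j , k) (suc (suc zero)) = k

-- the cycle (321) : 3 ↦ 2 ↦ 1 ↦ 3, written 0-indexed (factor m is Fin index m-1):
-- σ(1) = 3, σ(2) = 1, σ(3) = 2
cycle321 : Fin 3 → Fin 3
cycle321 zero = suc (suc zero)
cycle321 (suc zero) = zero
cycle321 (suc (suc zero)) = suc zero

module Tri {c ℓ : Level} (R : CommutativeRing c ℓ) where
  open CommutativeRing R hiding (zero)

  Σ2 : (Fin 2 → Carrier) → Carrier
  Σ2 f = f zero + f (suc zero)

  ΣI3 : (I3 → Carrier) → Carrier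
  ΣI3 f = Σ2 (λ i → Σ2 (λ j → Σ2 (λ k → f (i , j , k))))

  LV : Set c
  LV = Fin 2 → Fin 2 → Carrier

  _·_ : LV → LV → LV
  (a · b) i j = Σ2 (λ k → a i k * b k j)

  tr : LV → Carrier
  tr a = Σ2 (λ i → a i i)

  E : Fin 2 → Fin 2 → LV
  E p q i j with p ≟ i | q ≟ j
  ... | yes _ | yes _ = 1#
  ... | _     | _     = 0#

  LV3 : Set c
  LV3 = I3 → I3 → Carrier

  _∘₃_ : LV3 → LV3 → LV3
  (a ∘₃ b) i j = ΣI3 (λ k → a i k * b k j)

  Lmul : LV3 → LV3 → LV3
  Lmul t b = t ∘₃ b

  -- t_σ (u₁ ⊗ u₂ ⊗ u₃) = u_{σ(1)} ⊗ u_{σ(2)} ⊗ u_{σ(3)};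
  -- on basis vectors e_j ↦ e_i with i_m = j_{σ(m)}, so its matrix entry (i , j)
  -- is 1 iff comp i m ≡ comp j (σ m) for all m.
  tσ : (Fin 3 → Fin 3) → LV3
  tσ σ i j with (comp i zero ≟ comp j (σ zero))
                ×-dec ((comp i (suc zero) ≟ comp j (σ (suc zero)))
                ×-dec (comp i (suc (suc zero)) ≟ comp j (σ (suc (suc zero)))))
  ... | yes _ = 1#
  ... | no _  = 0#

  -- Trilinear forms on L(V), and their identification with elements of
  -- L(V^{⊗3})^* : the unique linear functional agreeing with φ on
  -- a₁ ⊗ a₂ ⊗ a₃; on b = Σ b_{ij} E_{i₁j₁} ⊗ E_{i₂j₂} ⊗ E_{i₃j₃} it is
  TriForm : Set c
  TriForm = LV → LV → LV → Carrier

  asFunctional : TriForm → LV3 → Carrier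
  asFunctional φ b =
    ΣI3 (λ i → ΣI3 (λ j → b i j * φ (E (comp i zero) (comp j zero))
                                     (E (comp i (suc zero)) (comp j (suc zero)))
                                     (E (comp i (suc (suc zero))) (comp j (suc (suc zero))))))

  g : TriForm
  g a₁ a₂ a₃ = tr (a₁ · (a₂ · a₃)) - tr (a₃ · (a₂ · a₁))

  h : TriForm
  h a₁ a₂ a₃ = tr a₁ * tr a₂ * tr a₃ - tr (a₁ · (a₂ · a₃))

{-# OPTIONS --safe #-}
module Submission where

open import Defs
open import Algebra.Bundles using (CommutativeRing)
import Algebra.Properties.CommutativeSemigroup as CommSemigroupProperties
import Algebra.Properties.Group as GroupProperties
open import Data.Fin using (Fin; zero; suc)
open import Data.Fin.Properties using (_≟_)
open import Data.Product using (_,_)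
open import Relation.Nullary using (yes; no)
open import Relation.Nullary.Negation using (contradiction)
import Relation.Binary.PropositionalEquality as ≡
import Relation.Binary.Reasoning.Setoid as SetoidReasoning

-- Both sides are linear in b, and ⟪ t ∘₃ b ∣ c ⟫ = ⟪ b ∣ tᵀ ∘₃ c ⟫ for the pairing
-- ⟪ b ∣ c ⟫ = Σ b_ij c_ij. As t_(321) is the permutation matrix of (k₁,k₂,k₃) ↦ (k₃,k₁,k₂), the
-- claim reduces to h(E_k₁j₁, E_k₂j₂, E_k₃j₃) = g(E_k₃j₁, E_k₁j₂, E_k₂j₃) on matrix units.
-- From tr E_pq = δ_pq and tr (E_pq E_rs E_uv) = δ_qr δ_su δ_vp both sides equal
-- δ_k₁j₁ δ_k₂j₂ δ_k₃j₃ − δ_j₁k₂ δ_j₂k₃ δ_j₃k₁.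

module MatrixUnits {c ℓ} (R : CommutativeRing c ℓ) where
  open CommutativeRing R hiding (zero)
  open Tri R
  open CommSemigroupProperties +-commutativeSemigroup using (interchange)
  open CommSemigroupProperties *-commutativeSemigroup using (xy∙z≈zy∙x; xy∙z≈y∙xz; x∙yz≈z∙yx)
  open GroupProperties +-group using () renaming (//-cong₂ to -‿cong₂)
  open SetoidReasoning setoid

  Σ2-cong : ∀ {f f′ : Fin 2 → Carrier} → (∀ i → f i ≈ f′ i) → Σ2 f ≈ Σ2 f′
  Σ2-cong f≈f′ = +-cong (f≈f′ zero) (f≈f′ (suc zero))

  ΣI3-cong : ∀ {f f′ : I3 → Carrier} → (∀ i → f i ≈ f′ i) → ΣI3 f ≈ ΣI3 f′
  ΣI3-cong f≈f′ = Σ2-cong λ a → Σ2-cong λ b → Σ2-cong λ c → f≈f′ (a , b , c)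

  Σ2-distrib-+-cong : ∀ {f f′ f″ : Fin 2 → Carrier} →
                      (∀ i → f i + f′ i ≈ f″ i) → Σ2 f + Σ2 f′ ≈ Σ2 f″
  Σ2-distrib-+-cong eq = trans (interchange _ _ _ _) (Σ2-cong eq)

  *-distribˡ-Σ2-cong : ∀ x {f f′ : Fin 2 → Carrier} →
                       (∀ i → x * f i ≈ f′ i) → x * Σ2 f ≈ Σ2 f′
  *-distribˡ-Σ2-cong x eq = trans (distribˡ x _ _) (Σ2-cong eq)

  ΣI3-distrib-+ : ∀ (f f′ : I3 → Carrier) → ΣI3 f + ΣI3 f′ ≈ ΣI3 (λ i → f i + f′ i)
  ΣI3-distrib-+ f f′ =
    Σ2-distrib-+-cong λ a → Σ2-distrib-+-cong λ b → Σ2-distrib-+-cong λ c →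
      refl {f (a , b , c) + f′ (a , b , c)}

  *-distribˡ-ΣI3 : ∀ x (f : I3 → Carrier) → x * ΣI3 f ≈ ΣI3 (λ i → x * f i)
  *-distribˡ-ΣI3 x f =
    *-distribˡ-Σ2-cong x λ a → *-distribˡ-Σ2-cong x λ b → *-distribˡ-Σ2-cong x λ c →
      refl {x * f (a , b , c)}

  *-distribʳ-ΣI3 : ∀ x (f : I3 → Carrier) → ΣI3 f * x ≈ ΣI3 (λ i → f i * x)
  *-distribʳ-ΣI3 x f =
    trans (*-comm _ x) (trans (*-distribˡ-ΣI3 x f) (ΣI3-cong λ i → *-comm x (f i)))

  Σ2-comm-ΣI3 : ∀ (f : Fin 2 → I3 → Carrier) →
                Σ2 (λ a → ΣI3 (f a)) ≈ ΣI3 (λ j → Σ2 (λ a → f a j))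
  Σ2-comm-ΣI3 f = ΣI3-distrib-+ (f zero) (f (suc zero))

  ΣI3-comm : ∀ (f : I3 → I3 → Carrier) →
             ΣI3 (λ i → ΣI3 (f i)) ≈ ΣI3 (λ j → ΣI3 (λ i → f i j))
  ΣI3-comm f = begin
    ΣI3 (λ i → ΣI3 (f i))
      ≈⟨ Σ2-cong (λ a → Σ2-cong λ b → Σ2-comm-ΣI3 λ c → f (a , b , c)) ⟩
    Σ2 (λ a → Σ2 (λ b → ΣI3 (λ j → Σ2 (λ c → f (a , b , c) j))))
      ≈⟨ Σ2-cong (λ a → Σ2-comm-ΣI3 λ b j → Σ2 λ c → f (a , b , c) j) ⟩
    Σ2 (λ a → ΣI3 (λ j → Σ2 (λ b → Σ2 (λ c → f (a , b , c) j))))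
      ≈⟨ Σ2-comm-ΣI3 (λ a j → Σ2 λ b → Σ2 λ c → f (a , b , c) j) ⟩
    ΣI3 (λ j → ΣI3 (λ i → f i j)) ∎

  δ : Fin 2 → Fin 2 → Carrier
  δ p q with p ≟ q
  ... | yes _ = 1#
  ... | no _  = 0#

  δ-sym : ∀ p q → δ p q ≈ δ q p
  δ-sym p q with p ≟ q | q ≟ p
  ... | yes _   | yes _   = refl
  ... | no _    | no _    = refl
  ... | yes p≡q | no q≢p  = contradiction (≡.sym p≡q) q≢p
  ... | no p≢q  | yes q≡p = contradiction (≡.sym q≡p) p≢q

  Σ2-δˡ : ∀ p (f : Fin 2 → Carrier) → Σ2 (λ i → δ p i * f i) ≈ f p
  Σ2-δˡ zero       f = begin
    1# * f zero + 0# * f (suc zero) ≈⟨ +-cong (*-identityˡ _) (zeroˡ _) ⟩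
    f zero + 0#                     ≈⟨ +-identityʳ _ ⟩
    f zero                          ∎
  Σ2-δˡ (suc zero) f = begin
    0# * f zero + 1# * f (suc zero) ≈⟨ +-cong (zeroˡ _) (*-identityˡ _) ⟩
    0# + f (suc zero)               ≈⟨ +-identityˡ _ ⟩
    f (suc zero)                    ∎

  Σ2-δʳ : ∀ p (f : Fin 2 → Carrier) → Σ2 (λ i → δ i p * f i) ≈ f p
  Σ2-δʳ p f = trans (Σ2-cong λ i → *-congʳ {f i} (δ-sym i p)) (Σ2-δˡ p f)

  E-δ : ∀ p q i j → E p q i j ≈ δ p i * δ q j
  E-δ p q i j with p ≟ i | q ≟ j
  ... | yes _ | yes _ = sym (*-identityˡ 1#)
  ... | yes _ | no _  = sym (zeroʳ 1#)
  ... | no _  | _     = sym (zeroˡ _)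

  E-· : ∀ p q (a : LV) i j → (E p q · a) i j ≈ δ p i * a q j
  E-· p q a i j = begin
    Σ2 (λ k → E p q i k * a k j)          ≈⟨ Σ2-cong (λ k → *-congʳ {a k j} (E-δ p q i k)) ⟩
    Σ2 (λ k → δ p i * δ q k * a k j)      ≈⟨ Σ2-cong (λ k → *-assoc (δ p i) (δ q k) (a k j)) ⟩
    Σ2 (λ k → δ p i * (δ q k * a k j))    ≈⟨ distribˡ _ _ _ ⟨
    δ p i * Σ2 (λ k → δ q k * a k j)      ≈⟨ *-congˡ (Σ2-δˡ q (λ k → a k j)) ⟩
    δ p i * a q j                         ∎

  tr-E : ∀ p q → tr (E p q) ≈ δ p q
  tr-E p q = begin
    Σ2 (λ i → E p q i i)       ≈⟨ Σ2-cong (λ i → E-δ p q i i) ⟩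
    Σ2 (λ i → δ p i * δ q i)   ≈⟨ Σ2-δˡ p (δ q) ⟩
    δ q p                      ≈⟨ δ-sym q p ⟩
    δ p q                      ∎

  tr-E· : ∀ p q (a : LV) → tr (E p q · a) ≈ a q p
  tr-E· p q a = trans (Σ2-cong λ i → E-· p q a i i) (Σ2-δˡ p (a q))

  tr-E·E·E : ∀ p q r s u v → tr (E p q · (E r s · E u v)) ≈ δ q r * δ s u * δ v p
  tr-E·E·E p q r s u v = begin
    tr (E p q · (E r s · E u v))  ≈⟨ tr-E· p q (E r s · E u v) ⟩
    (E r s · E u v) q p           ≈⟨ E-· r s (E u v) q p ⟩
    δ r q * E u v s p             ≈⟨ *-cong (δ-sym r q) (E-δ u v s p) ⟩
    δ q r * (δ u s * δ v p)       ≈⟨ *-congˡ (*-congʳ (δ-sym u s)) ⟩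
    δ q r * (δ s u * δ v p)       ≈⟨ *-assoc _ _ _ ⟨
    δ q r * δ s u * δ v p         ∎

  permute : (Fin 3 → Fin 3) → I3 → I3
  permute σ k = comp k (σ zero) , comp k (σ (suc zero)) , comp k (σ (suc (suc zero)))

  δ₃ : I3 → I3 → Carrier
  δ₃ (i₁ , i₂ , i₃) (j₁ , j₂ , j₃) = δ i₁ j₁ * (δ i₂ j₂ * δ i₃ j₃)

  tσ-δ₃ : ∀ σ i k → tσ σ i k ≈ δ₃ i (permute σ k)
  tσ-δ₃ σ (i₁ , i₂ , i₃) k
    with i₁ ≟ comp k (σ zero) | i₂ ≟ comp k (σ (suc zero)) | i₃ ≟ comp k (σ (suc (suc zero)))
  ... | yes _ | yes _ | yes _ = sym (trans (*-identityˡ _) (*-identityˡ _))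
  ... | yes _ | yes _ | no _  = sym (trans (*-identityˡ _) (*-identityˡ _))
  ... | yes _ | no _  | _     = sym (trans (*-identityˡ _) (zeroˡ _))
  ... | no _  | _     | _     = sym (zeroˡ _)

  ΣI3-δ₃ : ∀ k (f : I3 → Carrier) → ΣI3 (λ i → δ₃ i k * f i) ≈ f k
  ΣI3-δ₃ (p , q , r) f = begin
    ΣI3 (λ i → δ₃ i (p , q , r) * f i)
      ≈⟨ ΣI3-cong (λ (a , b , c) → reverse (δ a p) (δ b q) (δ c r) (f (a , b , c))) ⟩
    Σ2 (λ a → Σ2 (λ b → Σ2 (λ c → δ c r * (δ b q * (δ a p * f (a , b , c))))))
      ≈⟨ Σ2-cong (λ a → Σ2-cong λ b → Σ2-δʳ r λ c → δ b q * (δ a p * f (a , b , c))) ⟩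
    Σ2 (λ a → Σ2 (λ b → δ b q * (δ a p * f (a , b , r))))
      ≈⟨ Σ2-cong (λ a → Σ2-δʳ q λ b → δ a p * f (a , b , r)) ⟩
    Σ2 (λ a → δ a p * f (a , q , r))
      ≈⟨ Σ2-δʳ p (λ a → f (a , q , r)) ⟩
    f (p , q , r) ∎
    where
    reverse : ∀ x y z w → (x * (y * z)) * w ≈ z * (y * (x * w))
    reverse x y z w = begin
      x * (y * z) * w    ≈⟨ *-congʳ (x∙yz≈z∙yx x y z) ⟩
      z * (y * x) * w    ≈⟨ *-assoc z _ w ⟩
      z * (y * x * w)    ≈⟨ *-congˡ (*-assoc y x w) ⟩
      z * (y * (x * w))  ∎

  infix 30 _ᵀ
  _ᵀ : LV3 → LV3
  (t ᵀ) i j = t j i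

  ⟪_∣_⟫ : LV3 → LV3 → Carrier
  ⟪ b ∣ b′ ⟫ = ΣI3 λ i → ΣI3 λ j → b i j * b′ i j

  ⟪⟫-congʳ : ∀ b {b′ b″} → (∀ i j → b′ i j ≈ b″ i j) → ⟪ b ∣ b′ ⟫ ≈ ⟪ b ∣ b″ ⟫
  ⟪⟫-congʳ b eq = ΣI3-cong λ i → ΣI3-cong λ j → *-congˡ {b i j} (eq i j)

  ∘₃-adjoint : ∀ t b b′ → ⟪ t ∘₃ b ∣ b′ ⟫ ≈ ⟪ b ∣ t ᵀ ∘₃ b′ ⟫
  ∘₃-adjoint t b b′ = begin
    ΣI3 (λ i → ΣI3 λ j → ΣI3 (λ k → t i k * b k j) * b′ i j)
      ≈⟨ ΣI3-cong (λ i → ΣI3-cong λ j → *-distribʳ-ΣI3 (b′ i j) (λ k → t i k * b k j)) ⟩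
    ΣI3 (λ i → ΣI3 λ j → ΣI3 λ k → t i k * b k j * b′ i j)
      ≈⟨ ΣI3-comm (λ i j → ΣI3 λ k → t i k * b k j * b′ i j) ⟩
    ΣI3 (λ j → ΣI3 λ i → ΣI3 λ k → t i k * b k j * b′ i j)
      ≈⟨ ΣI3-cong (λ j → ΣI3-comm λ i k → t i k * b k j * b′ i j) ⟩
    ΣI3 (λ j → ΣI3 λ k → ΣI3 λ i → t i k * b k j * b′ i j)
      ≈⟨ ΣI3-comm (λ j k → ΣI3 λ i → t i k * b k j * b′ i j) ⟩
    ΣI3 (λ k → ΣI3 λ j → ΣI3 λ i → t i k * b k j * b′ i j)
      ≈⟨ ΣI3-cong (λ k → ΣI3-cong λ j → ΣI3-cong λ i → xy∙z≈y∙xz (t i k) (b k j) (b′ i j)) ⟩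
    ΣI3 (λ k → ΣI3 λ j → ΣI3 λ i → b k j * (t i k * b′ i j))
      ≈⟨ ΣI3-cong (λ k → ΣI3-cong λ j → *-distribˡ-ΣI3 (b k j) (λ i → t i k * b′ i j)) ⟨
    ΣI3 (λ k → ΣI3 λ j → b k j * ΣI3 (λ i → t i k * b′ i j)) ∎

  tσᵀ-∘₃ : ∀ σ b k j → (tσ σ ᵀ ∘₃ b) k j ≈ b (permute σ k) j
  tσᵀ-∘₃ σ b k j = begin
    ΣI3 (λ i → tσ σ i k * b i j)             ≈⟨ ΣI3-cong (λ i → *-congʳ {b i j} (tσ-δ₃ σ i k)) ⟩
    ΣI3 (λ i → δ₃ i (permute σ k) * b i j)   ≈⟨ ΣI3-δ₃ (permute σ k) (λ i → b i j) ⟩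
    b (permute σ k) j                        ∎

  -- asFunctional φ b is definitionally ⟪ b ∣ coefficients φ ⟫.
  coefficients : TriForm → LV3
  coefficients φ i j = φ (E (comp i zero) (comp j zero))
                         (E (comp i (suc zero)) (comp j (suc zero)))
                         (E (comp i (suc (suc zero))) (comp j (suc (suc zero))))

  coefficients-h : ∀ k j → coefficients h k j ≈ coefficients g (permute cycle321 k) j
  coefficients-h (k₁ , k₂ , k₃) (j₁ , j₂ , j₃) = begin
    tr (E k₁ j₁) * tr (E k₂ j₂) * tr (E k₃ j₃) - tr (E k₁ j₁ · (E k₂ j₂ · E k₃ j₃))
      ≈⟨ -‿cong₂ (*-cong (*-cong (tr-E k₁ j₁) (tr-E k₂ j₂)) (tr-E k₃ j₃))
                  (tr-E·E·E k₁ j₁ k₂ j₂ k₃ j₃) ⟩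
    δ k₁ j₁ * δ k₂ j₂ * δ k₃ j₃ - δ j₁ k₂ * δ j₂ k₃ * δ j₃ k₁
      ≈⟨ -‿cong₂ (*-cong (*-cong (δ-sym k₁ j₁) (δ-sym k₂ j₂)) (δ-sym k₃ j₃))
                  (xy∙z≈zy∙x (δ j₁ k₂) (δ j₂ k₃) (δ j₃ k₁)) ⟩
    δ j₁ k₁ * δ j₂ k₂ * δ j₃ k₃ - δ j₃ k₁ * δ j₂ k₃ * δ j₁ k₂
      ≈⟨ -‿cong₂ (tr-E·E·E k₃ j₁ k₁ j₂ k₂ j₃) (tr-E·E·E k₂ j₃ k₁ j₂ k₃ j₁) ⟨
    tr (E k₃ j₁ · (E k₁ j₂ · E k₂ j₃)) - tr (E k₂ j₃ · (E k₁ j₂ · E k₃ j₁)) ∎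

  h≈g∘Lt : ∀ b → asFunctional h b ≈ asFunctional g (Lmul (tσ cycle321) b)
  h≈g∘Lt b = begin
    ⟪ b ∣ coefficients h ⟫
      ≈⟨ ⟪⟫-congʳ b coefficients-h ⟩
    ⟪ b ∣ (λ k j → coefficients g (permute cycle321 k) j) ⟫
      ≈⟨ ⟪⟫-congʳ b (tσᵀ-∘₃ cycle321 (coefficients g)) ⟨
    ⟪ b ∣ tσ cycle321 ᵀ ∘₃ coefficients g ⟫
      ≈⟨ ∘₃-adjoint (tσ cycle321) b (coefficients g) ⟨
    ⟪ tσ cycle321 ∘₃ b ∣ coefficients g ⟫ ∎

lemma4p6 : ∀ {c ℓ} (F : Field c ℓ) →
    let open CommutativeRing (Field.ring F) using (_≈_) in
    let open Tri (Field.ring F) in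
    ∀ (b : LV3) → asFunctional h b ≈ asFunctional g (Lmul (tσ cycle321) b)
lemma4p6 F = MatrixUnits.h≈g∘Lt (Field.ring F)
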